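{- $b_2(C_4\,\square\,C_4)=5$ and $t_2(C_4\,\square\,C_4)=4$.
   Context: $C_4$ is the cycle on $4$ vertices. The Cartesian product $G\,\square\,H$ has vertex set $V(G)\times V(H)$, with $(u_1,v_1)$ adjacent to $(u_2,v_2)$ iff either $u_1=u_2$ and $v_1v_2\in E(H)$, or $v_1=v_2$ and $u_1u_2\in E(G)$. The 2-burning process: given a graph $G$ and a sequence $s=(s_1,\dots,s_k)$ of vertices of $G$ (sources), at round $0$ all vertices are uncolored; at each round $j\ge1$, (i) if $j\le k$ and $s_j$ is uncolored, $s_j$ is colored blue, and (ii) every uncolored vertex having at least two neighbors that were blue at the end of round $j-1$ is colored blue. $s$ is a 2-burning sequence if eventually all vertices are blue; $\mathrm{len}(s)=k$ and $\mathrm{rd}(s)$ is the first round at the end of which all vertices are blue. $b_2(G)$ is the minimum of $\mathrm{rd}(s)$ over all 2-burning sequences; a 2-burning sequence achieving it is optimal; $t_2(G)$ is the minimum length of an optimal 2-burning sequence. -}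

module Defs where

open import Data.Nat using (ℕ; zero; suc; _+_; _*_; _≤_; _<_; _≡ᵇ_; _%_; NonZero)
open import Data.Bool using (Bool; true; false; _∧_; _∨_)
open import Data.Fin using (Fin; toℕ; remQuot; _≟_)
open import Data.List using (List; length; filterᵇ; allFin; lookup)
open import Data.Product using (Σ; _×_; _,_; ∃)
open import Relation.Nullary using (¬_)
open import Relation.Nullary.Decidable using (⌊_⌋)
open import Relation.Binary.PropositionalEquality using (_≡_)

record Graph : Set where
  field
    order : ℕ
    adj   : Fin order → Fin order → Bool
open Graph public

Cycle : (n : ℕ) → .{{NonZero n}} → Graph
Cycle n = record
  { order = n
  ; adj = λ i j → (toℕ j ≡ᵇ (suc (toℕ i) % n)) ∨ (toℕ i ≡ᵇ (suc (toℕ j) % n))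
  }

-- Cartesian product G □ H; vertex set Fin (|G| * |H|) ≅ Fin |G| × Fin |H| via remQuot.
_□_ : Graph → Graph → Graph
G □ H = record
  { order = order G * order H
  ; adj = λ x y → padj (remQuot (order H) x) (remQuot (order H) y)
  }
  where
  padj : Fin (order G) × Fin (order H) → Fin (order G) × Fin (order H) → Bool
  padj (u₁ , v₁) (u₂ , v₂) =
    (⌊ u₁ ≟ u₂ ⌋ ∧ adj H v₁ v₂) ∨ (⌊ v₁ ≟ v₂ ⌋ ∧ adj G u₁ u₂)

-- Is the j-th source (1-indexed) of s equal to v?  (false if j = 0 or j > len s)
isSource : {n : ℕ} → List (Fin n) → ℕ → Fin n → Bool
isSource List.[] j v = false
isSource (s List.∷ ss) zero v = false
isSource (s List.∷ ss) (suc zero) v = ⌊ s ≟ v ⌋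
isSource (s List.∷ ss) (suc (suc j)) v = isSource ss (suc j) v

blue : (G : Graph) → List (Fin (order G)) → ℕ → Fin (order G) → Bool
blue G s zero v = false
blue G s (suc j) v =
  blue G s j v
  ∨ isSource s (suc j) v
  ∨ (2 Data.Nat.≤ᵇ length (filterᵇ (λ u → adj G v u ∧ blue G s j u) (allFin (order G))))

AllBlue : (G : Graph) → List (Fin (order G)) → ℕ → Set
AllBlue G s r = ∀ v → blue G s r v ≡ true

Is2Burning : (G : Graph) → List (Fin (order G)) → Set
Is2Burning G s = ∃ λ r → AllBlue G s r

IsRd : (G : Graph) → List (Fin (order G)) → ℕ → Set
IsRd G s r = AllBlue G s r × (∀ r′ → r′ < r → ¬ AllBlue G s r′)

IsB2 : Graph → ℕ → Set
IsB2 G b = (∃ λ s → IsRd G s b) × (∀ s r → IsRd G s r → b ≤ r)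

IsOptimal : (G : Graph) → List (Fin (order G)) → Set
IsOptimal G s = Σ ℕ λ b → IsB2 G b × IsRd G s b

IsT2 : Graph → ℕ → Set
IsT2 G t = (∃ λ s → IsOptimal G s × length s ≡ t)
         × (∀ s → IsOptimal G s → t ≤ length s)

C4□C4 : Graph
C4□C4 = Cycle 4 □ Cycle 4

{-# OPTIONS --safe #-}
module Submission where

-- Colouring is monotone in the round, and the colour of a vertex at round j
-- depends only on the first j sources.  Call a vertex a hole of a colouring
-- if it is uncoloured and has fewer than two blue neighbours: at the next
-- round it can only turn blue by being the next source.  An exhaustive
-- computation over the 1 + 16 + 16² + 16³ sequences of at most three sources
-- shows that after round 3 there are always two holes, so no sequence burns
-- C₄ □ C₄ by round 4, and that no sequence of at most three sources burns
-- it by round 5.  The four sources with both coordinates even burn it by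
-- round 5.

open import Defs
open import Data.Bool using (Bool; true; false; _∧_; _∨_)
import Data.Bool as Bool
open import Data.Bool.Properties using (T?; ∨-identityʳ)
open import Data.Fin using (Fin; _≟_; #_)
open import Data.Fin.Properties using (all?; any?)
open import Data.List using (List; []; _∷_; length; filterᵇ; allFin; take)
open import Data.List.Properties using (filter-≐; length-take)
open import Data.Nat using (ℕ; zero; suc; _≤_; _<_; _≤′_; ≤′-refl; ≤′-step; _≤ᵇ_; z≤n; s≤s; s≤s⁻¹)
open import Data.Nat.Properties using (≤-antisym; ≮⇒≥; <⇒≤; ≤⇒≤′; m⊓n≤m)
open import Data.Product using (_×_; _,_; ∃₂; proj₁; proj₂)
open import Data.Vec using (Vec; tabulate; lookup; replicate)
open import Data.Vec.Properties using (lookup∘tabulate; lookup-replicate)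
open import Function using (_∘_)
open import Relation.Binary.PropositionalEquality
  using (_≡_; _≢_; _≗_; refl; sym; trans; cong; cong₂; subst)
open import Relation.Nullary using (¬_; Dec; yes; no; ¬?; _×-dec_)
open import Relation.Nullary.Decidable using (map′; toWitness)

private
  variable
    A : Set
    G : Graph
    n b j k r : ℕ
    s : List A

Vertex : Graph → Set
Vertex G = Fin (order G)

neighbours : (G : Graph) → Vertex G → List (Vertex G)
neighbours G v = filterᵇ (adj G v) (allFin (order G))

ignites : (G : Graph) → (Vertex G → Bool) → Vertex G → Bool
ignites G c v = 2 ≤ᵇ length (filterᵇ (λ u → adj G v u ∧ c u) (allFin (order G)))

IsHole : (G : Graph) → (Vertex G → Bool) → Vertex G → Set
IsHole G c v = c v ≡ false × ignites G c v ≡ false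

TwoHoles : (G : Graph) → (Vertex G → Bool) → Set
TwoHoles G c = ∃₂ λ v w → v ≢ w × IsHole G c v × IsHole G c w

filterᵇ-cong : {f g : A → Bool} → f ≗ g → filterᵇ f ≗ filterᵇ g
filterᵇ-cong f≗g = filter-≐ (T? ∘ _) (T? ∘ _)
  ((λ {x} → subst Bool.T (f≗g x)) , (λ {x} → subst Bool.T (sym (f≗g x))))

filterᵇ-∧ : (f g : A → Bool) (xs : List A) →
            filterᵇ (λ x → f x ∧ g x) xs ≡ filterᵇ g (filterᵇ f xs)
filterᵇ-∧ f g [] = refl
filterᵇ-∧ f g (x ∷ xs) with f x
... | false = filterᵇ-∧ f g xs
... | true with g x
...   | true  = cong (x ∷_) (filterᵇ-∧ f g xs)
...   | false = filterᵇ-∧ f g xs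

ignites-cong : (G : Graph) {c c′ : Vertex G → Bool} → c ≗ c′ → ignites G c ≗ ignites G c′
ignites-cong G c≗c′ v = cong (λ xs → 2 ≤ᵇ length xs)
  (filterᵇ-cong (λ u → cong (adj G v u ∧_) (c≗c′ u)) (allFin (order G)))

ignites-neighbours : (G : Graph) (c : Vertex G → Bool) (v : Vertex G) →
                     ignites G c v ≡ (2 ≤ᵇ length (filterᵇ c (neighbours G v)))
ignites-neighbours G c v =
  cong (λ xs → 2 ≤ᵇ length xs) (filterᵇ-∧ (adj G v) c (allFin (order G)))

TwoHoles-cong : {c c′ : Vertex G → Bool} → c ≗ c′ → TwoHoles G c → TwoHoles G c′
TwoHoles-cong {G} {c} {c′} c≗c′ (v , w , v≢w , hole-v , hole-w) =
  v , w , v≢w , transport hole-v , transport hole-w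
  where
  transport : ∀ {x} → IsHole G c x → IsHole G c′ x
  transport {x} (white , cold) =
    trans (sym (c≗c′ x)) white , trans (sym (ignites-cong G c≗c′ x)) cold

isSource-injective : (s : List (Fin n)) (j : ℕ) {v w : Fin n} →
                     isSource s j v ≡ true → isSource s j w ≡ true → v ≡ w
isSource-injective (x ∷ xs) (suc zero) {v} {w} p q with x ≟ v | x ≟ w
isSource-injective (x ∷ xs) (suc zero) p q | yes refl | yes refl = refl
isSource-injective (x ∷ xs) (suc zero) () q | no _ | _
isSource-injective (x ∷ xs) (suc zero) p () | yes _ | no _
isSource-injective (x ∷ xs) (suc (suc j)) p q = isSource-injective xs (suc j) p q

isSource-take : (s : List (Fin n)) (v : Fin n) → k ≤ j → isSource (take j s) k v ≡ isSource s k v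
isSource-take {j = zero}  []       v _ = refl
isSource-take {j = suc _} []       v _ = refl
isSource-take {j = zero}  (x ∷ xs) v z≤n = refl
isSource-take {k = zero}  {suc _} (x ∷ xs) v _ = refl
isSource-take {k = suc zero} {suc _} (x ∷ xs) v _ = refl
isSource-take {k = suc (suc _)} {suc (suc _)} (x ∷ xs) v (s≤s k≤j) = isSource-take xs v k≤j

blue-take : (s : List (Vertex G)) → k ≤ j → blue G (take j s) k ≗ blue G s k
blue-take {k = zero} s _ v = refl
blue-take {G} {suc k} s k<j v =
  cong₂ _∨_ (earlier v) (cong₂ _∨_ (isSource-take s v k<j) (ignites-cong G earlier v))
  where
  earlier : blue G (take _ s) k ≗ blue G s k
  earlier = blue-take s (<⇒≤ k<j)

AllBlue-suc : AllBlue G s j → AllBlue G s (suc j)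
AllBlue-suc {G} {s = s} {j} all v =
  cong (_∨ isSource s (suc j) v ∨ ignites G (blue G s j) v) (all v)

AllBlue-mono : {s : List (Vertex G)} → j ≤ k → AllBlue G s j → AllBlue G s k
AllBlue-mono {G} {j} {s = s} j≤k = go (≤⇒≤′ j≤k)
  where
  go : ∀ {k} → j ≤′ k → AllBlue G s j → AllBlue G s k
  go ≤′-refl               all = all
  go (≤′-step {k} j≤′k) all = AllBlue-suc {G} {s = s} {k} (go j≤′k all)

hole-needs-source : {s : List (Vertex G)} {v : Vertex G} → IsHole G (blue G s j) v →
                    blue G s (suc j) v ≡ true → isSource s (suc j) v ≡ true
hole-needs-source {j = j} {s} {v} (white , cold) burnt =
  trans (sym (∨-identityʳ _))
    (trans (sym (cong₂ (λ a c → a ∨ isSource s (suc j) v ∨ c) white cold)) burnt)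

TwoHoles⇒¬AllBlue : (s : List (Vertex G)) → TwoHoles G (blue G s j) → ¬ AllBlue G s (suc j)
TwoHoles⇒¬AllBlue {G} {j} s (v , w , v≢w , hole-v , hole-w) all =
  v≢w (isSource-injective s (suc j)
        (hole-needs-source {G} {j} hole-v (all v)) (hole-needs-source {G} {j} hole-w (all w)))

IsRd-intro : {s : List (Vertex G)} → AllBlue G s (suc r) → ¬ AllBlue G s r → IsRd G s (suc r)
IsRd-intro {G} {s = s} burnt unburnt =
  burnt , λ r′ r′<1+r all → unburnt (AllBlue-mono {G = G} {s = s} (s≤s⁻¹ r′<1+r) all)

IsB2-intro : {s₀ : List (Vertex G)} → IsRd G s₀ (suc b) →
             (∀ s → ¬ AllBlue G s b) → IsB2 G (suc b)
IsB2-intro {G} {s₀ = s₀} rd unburnt = (s₀ , rd) , λ s r (burnt , _) →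
  ≮⇒≥ λ r<1+b → unburnt s (AllBlue-mono {G = G} {s = s} (s≤s⁻¹ r<1+b) burnt)

IsB2-unique : IsB2 G b → IsB2 G k → b ≡ k
IsB2-unique ((s , rd) , least) ((s′ , rd′) , least′) = ≤-antisym (least s′ _ rd′) (least′ s _ rd)

optimal⇒AllBlue : {s : List (Vertex G)} → IsB2 G b → IsOptimal G s → AllBlue G s b
optimal⇒AllBlue {G} {s = s} b₂ (_ , b₂′ , rd) = subst (AllBlue G s) (IsB2-unique b₂′ b₂) (proj₁ rd)

IsT2-intro : {s₀ : List (Vertex G)} {t : ℕ} → IsB2 G b → IsRd G s₀ b → length s₀ ≡ t →
             (∀ s → length s < t → ¬ AllBlue G s b) → IsT2 G t
IsT2-intro {b = b} {s₀ = s₀} b₂ rd len unburnt =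
  (s₀ , (b , b₂ , rd) , len) , λ s opt → ≮⇒≥ λ short → unburnt s short (optimal⇒AllBlue b₂ opt)

all-length≤? : {P : List (Fin n) → Set} → ∀ k → (∀ p → Dec (P p)) →
               Dec (∀ p → length p ≤ k → P p)
all-length≤? zero P? = map′ (λ { P[] [] _ → P[] }) (λ all → all [] z≤n) (P? [])
all-length≤? (suc k) P? =
  map′ (λ { (P[] , _) [] _ → P[] ; (_ , P∷) (a ∷ p) (s≤s l) → P∷ a p l })
       (λ all → all [] z≤n , λ a p l → all (a ∷ p) (s≤s l))
       (P? [] ×-dec all? λ a → all-length≤? k λ p → P? (a ∷ p))

-- The neighbour lists are a parameter, and the exhaustive check over prefixes
-- is assembled inside this module, so that evaluating the check computes the
-- lists once and shares them across all the colourings; otherwise the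
-- adjacency function would be re-evaluated for every prefix.
module Simulation (G : Graph) (N : Vec (List (Vertex G)) (order G))
                  (N-neighbours : ∀ v → lookup N v ≡ neighbours G v) where

  ignitesᴺ : (Vertex G → Bool) → Vertex G → Bool
  ignitesᴺ c v = 2 ≤ᵇ length (filterᵇ c (lookup N v))

  ignites≗ignitesᴺ : (c : Vertex G → Bool) → ignites G c ≗ ignitesᴺ c
  ignites≗ignitesᴺ c v =
    trans (ignites-neighbours G c v) (cong (λ xs → 2 ≤ᵇ length (filterᵇ c xs)) (sym (N-neighbours v)))

  step : List (Vertex G) → ℕ → Vec Bool (order G) → Vec Bool (order G)
  step s j c = tabulate λ v → lookup c v ∨ isSource s j v ∨ ignitesᴺ (lookup c) v

  colouring : List (Vertex G) → ℕ → Vec Bool (order G)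
  colouring s zero    = replicate _ false
  colouring s (suc j) = step s (suc j) (colouring s j)

  colouring≗blue : (s : List (Vertex G)) (j : ℕ) → lookup (colouring s j) ≗ blue G s j
  colouring≗blue s zero    v = lookup-replicate v false
  colouring≗blue s (suc j) v = trans
    (lookup∘tabulate (λ u → lookup c u ∨ isSource s (suc j) u ∨ ignitesᴺ (lookup c) u) v)
    (cong₂ (λ a d → a ∨ isSource s (suc j) v ∨ d) (colouring≗blue s j v) ignition)
    where
    c = colouring s j
    ignition : ignitesᴺ (lookup c) v ≡ ignites G (blue G s j) v
    ignition = trans (sym (ignites≗ignitesᴺ (lookup c) v)) (ignites-cong G (colouring≗blue s j) v)

  isHole? : (c : Vertex G → Bool) (v : Vertex G) → Dec (IsHole G c v)
  isHole? c v = map′ (λ (white , cold) → white , trans (ignites≗ignitesᴺ c v) cold)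
                     (λ (white , cold) → white , trans (sym (ignites≗ignitesᴺ c v)) cold)
                     (c v Bool.≟ false ×-dec ignitesᴺ c v Bool.≟ false)

  twoHoles? : (c : Vertex G → Bool) → Dec (TwoHoles G c)
  twoHoles? c = any? λ v → any? λ w → ¬? (v ≟ w) ×-dec isHole? c v ×-dec isHole? c w

  twoHolesAt? : (s : List (Vertex G)) (j : ℕ) → Dec (TwoHoles G (blue G s j))
  twoHolesAt? s j = map′ (TwoHoles-cong (colouring≗blue s j))
                         (TwoHoles-cong (sym ∘ colouring≗blue s j))
                         (twoHoles? (lookup (colouring s j)))

  allBlue? : (s : List (Vertex G)) (j : ℕ) → Dec (AllBlue G s j)
  allBlue? s j = map′ (λ all v → trans (sym (colouring≗blue s j v)) (all v))
                      (λ all v → trans (colouring≗blue s j v) (all v))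
                      (all? λ v → lookup (colouring s j) v Bool.≟ true)

  stuckPrefixes? : ∀ k j → Dec (∀ p → length p ≤ k →
                                TwoHoles G (blue G p j) × ¬ AllBlue G p (suc (suc j)))
  stuckPrefixes? k j = all-length≤? k λ p → twoHolesAt? p j ×-dec ¬? (allBlue? p (suc (suc j)))

open Simulation C4□C4 (tabulate (neighbours C4□C4)) (lookup∘tabulate (neighbours C4□C4))

stuck-prefixes : ∀ p → length p ≤ 3 → TwoHoles C4□C4 (blue C4□C4 p 3) × ¬ AllBlue C4□C4 p 5
stuck-prefixes = toWitness {a? = stuckPrefixes? 3 3} _

¬AllBlue-4 : (s : List (Fin 16)) → ¬ AllBlue C4□C4 s 4
¬AllBlue-4 s = TwoHoles⇒¬AllBlue {C4□C4} {3} s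
  (TwoHoles-cong {C4□C4} (blue-take {C4□C4} s (s≤s (s≤s (s≤s z≤n))))
    (proj₁ (stuck-prefixes (take 3 s) (subst (_≤ 3) (sym (length-take 3 s)) (m⊓n≤m 3 _)))))

-- Vertex 4 x + y is (x , y) ∈ C₄ × C₄.
evenPoints : List (Fin 16)
evenPoints = # 0 ∷ # 2 ∷ # 8 ∷ # 10 ∷ []

evenPoints-rd : IsRd C4□C4 evenPoints 5
evenPoints-rd = IsRd-intro {C4□C4} (toWitness {a? = allBlue? evenPoints 5} _) (¬AllBlue-4 evenPoints)

theorem8 : IsB2 C4□C4 5 × IsT2 C4□C4 4
theorem8 = b₂ , IsT2-intro {C4□C4} b₂ evenPoints-rd refl
                  (λ s short → proj₂ (stuck-prefixes s (s≤s⁻¹ short)))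
  where
  b₂ : IsB2 C4□C4 5
  b₂ = IsB2-intro {C4□C4} evenPoints-rd ¬AllBlue-4
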